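{- Let $D$ be a diagram with $|G(D)|=0$. If the ghost Kohnert poset $\mathcal{P}_G(D)$ is bounded, then the free cell sequence of $D$ is strictly increasing.
   Context: A diagram is a finite set of cells placed at positions $(r,c)\in\mathbb{Z}_{>0}\times\mathbb{Z}_{>0}$ ($r$ the row, counted from the bottom; $c$ the column), each position holding at most one cell; each cell is either an ordinary cell, written $(r,c)$, or a ghost cell, written $\langle r,c\rangle$. A position is empty if it holds no cell of either kind. $G(D)$ denotes the set of ghost cells of $D$. The ghost move at row $r$ of $D$, with result denoted $\mathcal{G}(D,r)$, is defined as follows: if row $r$ is empty, $\mathcal{G}(D,r)=D$. Otherwise let $c$ be the largest column of a cell in row $r$. If this rightmost cell is a ghost cell, or there is no empty position $(\hat r,c)$ with $\hat r<r$, or, letting $\hat r<r$ be maximal with $(\hat r,c)$ empty, there is a ghost cell $\langle r^*,c\rangle$ with $\hat r<r^*<r$, then $\mathcal{G}(D,r)=D$. Otherwise, with $\hat r<r$ maximal such that $(\hat r,c)$ is empty, $\mathcal{G}(D,r)=(D\setminus\{(r,c)\})\cup\{(\hat r,c),\langle r,c\rangle\}$. $\mathrm{GKD}(D)$ is the set of all diagrams obtainable from $D$ by finite (possibly empty) sequences of ghost moves. The ghost Kohnert poset $\mathcal{P}_G(D)$ has underlying set $\mathrm{GKD}(D)$, with $D_2\preceq D_1$ iff $D_2$ can be obtained from $D_1$ by a finite (possibly empty) sequence of ghost moves. A poset is bounded if it has a unique minimal element and a unique maximal element. For a diagram $D$ with no ghost cells, let $FR(D)$ be the set of rows $r$ for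 which there exist $\hat r<r$ and $c$ with $(r,c)\in D$, $(\hat r,c)\notin D$, and $(r,\tilde c)\notin D$ for all $\tilde c>c$ (rows whose rightmost cell has an empty position somewhere below it in its column). Writing $FR(D)=\{r_1>r_2>\dots>r_n\}$, the free cell sequence of $D$ is $(c_1,\dots,c_n)$ where $c_i=\max\{c : (r_i,c)\in D\}$. -}

module Defs where

open import Data.Nat using (ℕ; _<_; _≤_)
open import Data.Product using (Σ; ∃; _×_; _,_)
open import Data.Sum using (_⊎_)
open import Relation.Binary.PropositionalEquality using (_≡_; _≢_)
open import Relation.Nullary using (¬_)

data Cell : Set where
  empty ordinary ghost : Cell

-- Convention: D i j is the content of position (row i+1, column j+1),
-- so that ℕ × ℕ ranges exactly over ℤ>0 × ℤ>0; the order on rows/columns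
-- is preserved by the shift.
Grid : Set
Grid = ℕ → ℕ → Cell

Finite : Grid → Set
Finite D = ∃ λ N → ∀ i j → (N ≤ i ⊎ N ≤ j) → D i j ≡ empty

NoGhosts : Grid → Set
NoGhosts D = ∀ i j → D i j ≢ ghost

_≈D_ : Grid → Grid → Set
D ≈D E = ∀ i j → D i j ≡ E i j

-- A ghost move at row r that changes the diagram (all other cases of the
-- definition of 𝒢(D,r) return D itself, hence are irrelevant to
-- reachability).  Unfolding the definition: the rightmost cell of row r is
-- an ordinary cell (r,c); r̂ < r is maximal with (r̂,c) empty, i.e. every
-- (k,c) with r̂ < k < r is nonempty; no ghost cell ⟨k,c⟩ with r̂ < k < r;
-- and E = (D ∖ {(r,c)}) ∪ {(r̂,c), ⟨r,c⟩}.
GhostMoveAt : Grid → ℕ → Grid → Set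
GhostMoveAt D r E = Σ ℕ λ c → Σ ℕ λ r̂ →
    D r c ≡ ordinary
  × (∀ c' → c < c' → D r c' ≡ empty)
  × r̂ < r
  × D r̂ c ≡ empty
  × (∀ k → r̂ < k → k < r → D k c ≢ empty)
  × (∀ k → r̂ < k → k < r → D k c ≢ ghost)
  × E r c ≡ ghost
  × E r̂ c ≡ ordinary
  × (∀ i j → ¬ (i ≡ r × j ≡ c) → ¬ (i ≡ r̂ × j ≡ c) → E i j ≡ D i j)

Step : Grid → Grid → Set
Step D E = ∃ λ r → GhostMoveAt D r E

data Reach (D : Grid) : Grid → Set where
  done : ∀ {E} → D ≈D E → Reach D E
  step : ∀ {E F} → Reach D E → Step E F → Reach D F

_⪯_ : Grid → Grid → Set
D₂ ⪯ D₁ = Reach D₁ D₂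

IsMinimal : Grid → Grid → Set
IsMinimal D M = Reach D M × (∀ X → Reach D X → X ⪯ M → X ≈D M)

IsMaximal : Grid → Grid → Set
IsMaximal D M = Reach D M × (∀ X → Reach D X → M ⪯ X → X ≈D M)

Bounded : Grid → Set
Bounded D =
    (∃ λ m → IsMinimal D m × (∀ m' → IsMinimal D m' → m' ≈D m))
  × (∃ λ M → IsMaximal D M × (∀ M' → IsMaximal D M' → M' ≈D M))

RightmostCol : Grid → ℕ → ℕ → Set
RightmostCol D r c = D r c ≢ empty × (∀ c' → c < c' → D r c' ≡ empty)

-- r ∈ FR(D) (for D without ghost cells)
FreeRow : Grid → ℕ → Set
FreeRow D r = ∃ λ c → ∃ λ r̂ →
  r̂ < r × D r c ≡ ordinary × D r̂ c ≡ empty × (∀ c' → c < c' → D r c' ≡ empty)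

-- The free cell sequence (c₁,…,cₙ), indexed by FR(D) = {r₁ > … > rₙ},
-- cᵢ the rightmost column of row rᵢ, is strictly increasing:
-- whenever rᵢ > rⱼ (i.e. i < j) we have cᵢ < cⱼ.
FreeCellSeqStrictlyIncreasing : Grid → Set
FreeCellSeqStrictlyIncreasing D =
  ∀ r r' c c' → FreeRow D r → FreeRow D r' → r' < r →
    RightmostCol D r c → RightmostCol D r' c' → c < c'

-- Ghost moves never remove a ghost and strictly decrease a weight on the finite box holding D,
-- so from every diagram of GKD(D) a terminal diagram is reachable; terminal diagrams are
-- minimal, hence all equal to the unique minimal element. Consequently a ghost that appears
-- somewhere in GKD(D) is eventually created starting from any diagram of GKD(D).
--
-- Suppose free rows r' < r have rightmost columns c' ≤ c; we may assume that no row in between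
-- reaches right of column c. Let the cell (r, c) fall repeatedly down column c until it lands
-- at or below row r'. If c' < c it lands on (r', c), after which (r', c') can never become a
-- ghost, although moving row r' first makes it one. If c' = c it lands below r'; moving row r'
-- first instead leaves a ghost at (r', c) under a filled column segment, after which (r, c) can
-- never become a ghost, although the fall made it one.
module Submission where

open import Defs
open import Data.Nat using (ℕ; zero; suc; _+_; _<_; _≤_; _≟_; _≤?_; z≤n; s≤s)
open import Data.Nat.Properties
open import Data.Nat.Induction using (<-wellFounded)
open import Data.Product using (∃; _×_; _,_; proj₁; proj₂)
open import Data.Sum using (_⊎_; inj₁; inj₂)
import Data.Sum as Sum
open import Data.Empty using (⊥; ⊥-elim)
open import Function using (_∘_)
open import Induction.WellFounded using (Acc; acc)
open import Relation.Binary.PropositionalEquality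
  using (_≡_; _≢_; refl; sym; trans; subst; subst₂; module ≡-Reasoning)
open import Relation.Binary.Definitions using (tri<; tri≈; tri>)
open import Relation.Nullary using (¬_; Dec; yes; no)
open import Relation.Nullary.Decidable using (¬?; decidable-stable; ¬¬-excluded-middle)

empty? : (a : Cell) → Dec (a ≡ empty)
empty? empty    = yes refl
empty? ordinary = no λ ()
empty? ghost    = no λ ()

≡ordinary⇒≢empty : ∀ {a} → a ≡ ordinary → a ≢ empty
≡ordinary⇒≢empty refl ()

≡ordinary⇒≢ghost : ∀ {a} → a ≡ ordinary → a ≢ ghost
≡ordinary⇒≢ghost refl ()

≡empty⇒≢ghost : ∀ {a} → a ≡ empty → a ≢ ghost
≡empty⇒≢ghost refl ()

≢empty∧≢ghost⇒≡ordinary : ∀ {a} → a ≢ empty → a ≢ ghost → a ≡ ordinary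
≢empty∧≢ghost⇒≡ordinary {empty}    a≢empty _ = ⊥-elim (a≢empty refl)
≢empty∧≢ghost⇒≡ordinary {ordinary} _       _ = refl
≢empty∧≢ghost⇒≡ordinary {ghost}    _ a≢ghost = ⊥-elim (a≢ghost refl)

greatest-below : {P : ℕ → Set} → (∀ k → Dec (P k)) → ∀ {f t} → P f → f < t →
  ∃ λ e → f ≤ e × e < t × P e × (∀ k → e < k → k < t → ¬ P k)
greatest-below P? {t = suc t} pf (s≤s f≤t) with P? t
... | yes pt = t , f≤t , ≤-refl , pt , λ k t<k k<1+t → ⊥-elim (<⇒≱ t<k (≤-pred k<1+t))
... | no ¬pt with greatest-below P? pf (≤∧≢⇒< f≤t λ { refl → ¬pt pf })
...   | e , f≤e , e<t , pe , none-above = e , f≤e , m<n⇒m<1+n e<t , pe , none-above′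
  where
  none-above′ : ∀ k → e < k → k < suc t → ¬ _
  none-above′ k e<k k<1+t with m≤n⇒m<n∨m≡n (≤-pred k<1+t)
  ... | inj₁ k<t = none-above k e<k k<t
  ... | inj₂ refl = ¬pt

sum< : ℕ → (ℕ → ℕ) → ℕ
sum< zero    f = 0
sum< (suc n) f = f n + sum< n f

sum<-mono-≤ : ∀ n {f g} → (∀ k → k < n → f k ≤ g k) → sum< n f ≤ sum< n g
sum<-mono-≤ zero    f≤g = z≤n
sum<-mono-≤ (suc n) f≤g = +-mono-≤ (f≤g n ≤-refl) (sum<-mono-≤ n λ k k<n → f≤g k (m<n⇒m<1+n k<n))

sum<-mono-< : ∀ n {f g} → (∀ k → k < n → f k ≤ g k) → ∀ {k} → k < n → f k < g k →
  sum< n f < sum< n g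
sum<-mono-< (suc n) f≤g {k} (s≤s k≤n) fk<gk with m≤n⇒m<n∨m≡n k≤n
... | inj₂ refl = +-mono-<-≤ fk<gk (sum<-mono-≤ n λ j j<n → f≤g j (m<n⇒m<1+n j<n))
... | inj₁ k<n  =
  +-mono-≤-< (f≤g n ≤-refl) (sum<-mono-< n (λ j j<n → f≤g j (m<n⇒m<1+n j<n)) k<n fk<gk)

Box : ℕ → Grid → Set
Box N X = ∀ i j → N ≤ i ⊎ N ≤ j → X i j ≡ empty

inside-box : ∀ {N X i j} → Box N X → X i j ≢ empty → i < N × j < N
inside-box {N} {i = i} {j} box nonempty with N ≤? i | N ≤? j
... | yes N≤i | _       = ⊥-elim (nonempty (box i j (inj₁ N≤i)))
... | no _    | yes N≤j = ⊥-elim (nonempty (box i j (inj₂ N≤j)))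
... | no i≱N  | no j≱N  = ≰⇒> i≱N , ≰⇒> j≱N

-- A ghost move turns one ordinary cell into a ghost and one empty position into an
-- ordinary cell, so it lowers this weight at one position and raises it nowhere.
weight : Cell → ℕ
weight empty    = 2
weight ordinary = 1
weight ghost    = 0

potential : ℕ → Grid → ℕ
potential N X = sum< N λ i → sum< N λ j → weight (X i j)

record RightmostOrdinary (Z : Grid) (r c : ℕ) : Set where
  constructor rightmost
  field
    ordinary-at  : Z r c ≡ ordinary
    empty-beyond : ∀ c' → c < c' → Z r c' ≡ empty

record Landing (Z : Grid) (t c e : ℕ) : Set where
  constructor landing
  field
    landing<top              : e < t
    empty-landing            : Z e c ≡ empty
    occupied-above-landing   : ∀ k → e < k → k < t → Z k c ≢ empty
    ghost-free-above-landing : ∀ k → e < k → k < t → Z k c ≢ ghost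

open RightmostOrdinary
open Landing

data StepAt (E F : Grid) (i j : ℕ) : Set where
  vacated   : RightmostOrdinary E i j → (∃ λ e → Landing E i j e) → F i j ≡ ghost →
              StepAt E F i j
  landed    : E i j ≡ empty → F i j ≡ ordinary → (∃ λ k → i < k × E k j ≡ ordinary) →
              StepAt E F i j
  unchanged : F i j ≡ E i j → StepAt E F i j

step-at : ∀ {E F} → Step E F → ∀ i j → StepAt E F i j
step-at (ρ , γ , ρ̂ , o , rm , ρ̂<ρ , em , bne , bng , Fg , Fo , frame) i j
  with i ≟ ρ | i ≟ ρ̂ | j ≟ γ
... | yes refl | _        | yes refl = vacated (rightmost o rm) (ρ̂ , landing ρ̂<ρ em bne bng) Fg
... | no _     | yes refl | yes refl = landed em Fo (ρ , ρ̂<ρ , o)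
... | no i≢ρ   | no i≢ρ̂   | _        = unchanged (frame i j (i≢ρ ∘ proj₁) (i≢ρ̂ ∘ proj₁))
... | _        | _        | no j≢γ   = unchanged (frame i j (j≢γ ∘ proj₂) (j≢γ ∘ proj₂))

ghost-preserved : ∀ {E F i j} → Step E F → E i j ≡ ghost → F i j ≡ ghost
ghost-preserved {i = i} {j} s ghost-at with step-at s i j
... | vacated top _ _ = ⊥-elim (≡ordinary⇒≢ghost (ordinary-at top) ghost-at)
... | landed e _ _    = ⊥-elim (≡empty⇒≢ghost e ghost-at)
... | unchanged eq    = trans eq ghost-at

nonempty-preserved : ∀ {E F i j} → Step E F → E i j ≢ empty → F i j ≢ empty
nonempty-preserved {i = i} {j} s nonempty with step-at s i j
... | vacated _ _ g = λ F-empty → ≡empty⇒≢ghost F-empty g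
... | landed e _ _  = ⊥-elim (nonempty e)
... | unchanged eq  = nonempty ∘ trans (sym eq)

new-ghost : ∀ {E F i j} → Step E F → E i j ≢ ghost → F i j ≡ ghost →
  RightmostOrdinary E i j × ∃ (Landing E i j)
new-ghost {i = i} {j} s old new with step-at s i j
... | vacated top l _ = top , l
... | landed _ o _    = ⊥-elim (≡ordinary⇒≢ghost o new)
... | unchanged eq    = ⊥-elim (old (trans (sym eq) new))

box-preserved : ∀ {N E F} → Step E F → Box N E → Box N F
box-preserved s box i j outside with step-at s i j
... | vacated top _ _ = ⊥-elim (≡ordinary⇒≢empty (ordinary-at top) (box i j outside))
... | landed _ _ (k , i<k , o) =
  ⊥-elim (≡ordinary⇒≢empty o (box k j (Sum.map₁ (λ N≤i → ≤-trans N≤i (<⇒≤ i<k)) outside)))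
... | unchanged eq = trans eq (box i j outside)

weight-nonincreasing : ∀ {E F} → Step E F → ∀ i j → weight (F i j) ≤ weight (E i j)
weight-nonincreasing s i j with step-at s i j
... | vacated top _ g rewrite ordinary-at top | g = z≤n
... | landed e o _ rewrite e | o = s≤s z≤n
... | unchanged eq rewrite eq = ≤-refl

potential-decreasing : ∀ {N E F} → Box N E → Step E F → potential N F < potential N E
potential-decreasing {N} {E} {F} box s@(ρ , γ , _ , o , _ , _ , _ , _ , _ , Fg , _)
  with inside-box box (≡ordinary⇒≢empty o)
... | ρ<N , γ<N =
  sum<-mono-< N (λ i _ → sum<-mono-≤ N λ j _ → weight-nonincreasing s i j) ρ<N
    (sum<-mono-< N (λ j _ → weight-nonincreasing s ρ j) γ<N
      (subst₂ (λ a b → weight a < weight b) (sym Fg) (sym o) (s≤s z≤n)))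

≈D-refl : ∀ {X} → X ≈D X
≈D-refl i j = refl

Step-respˡ : ∀ {E E′ F} → E ≈D E′ → Step E F → Step E′ F
Step-respˡ eq (ρ , γ , ρ̂ , o , rm , ρ̂<ρ , em , bne , bng , Fg , Fo , frame) =
  ρ , γ , ρ̂ , trans (sym (eq ρ γ)) o , (λ c c> → trans (sym (eq ρ c)) (rm c c>)) , ρ̂<ρ ,
  trans (sym (eq ρ̂ γ)) em , (λ k k> k< → bne k k> k< ∘ trans (eq k γ)) ,
  (λ k k> k< → bng k k> k< ∘ trans (eq k γ)) , Fg , Fo ,
  λ i j ¬top ¬landing → trans (frame i j ¬top ¬landing) (eq i j)

Step-respʳ : ∀ {E F F′} → F ≈D F′ → Step E F → Step E F′
Step-respʳ eq (ρ , γ , ρ̂ , o , rm , ρ̂<ρ , em , bne , bng , Fg , Fo , frame) =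
  ρ , γ , ρ̂ , o , rm , ρ̂<ρ , em , bne , bng , trans (sym (eq ρ γ)) Fg , trans (sym (eq ρ̂ γ)) Fo ,
  λ i j ¬top ¬landing → trans (sym (eq i j)) (frame i j ¬top ¬landing)

Reach-respʳ : ∀ {X Y Z} → Reach X Y → Y ≈D Z → Reach X Z
Reach-respʳ (done X≈Y)   Y≈Z = done λ i j → trans (X≈Y i j) (Y≈Z i j)
Reach-respʳ (step X↝ s) Y≈Z = step X↝ (Step-respʳ Y≈Z s)

Reach-trans : ∀ {X Y Z} → Reach X Y → Reach Y Z → Reach X Z
Reach-trans X↝Y (done Y≈Z)   = Reach-respʳ X↝Y Y≈Z
Reach-trans X↝Y (step Y↝ s) = step (Reach-trans X↝Y Y↝) s

Reach-preserves : (I : Grid → Set) → (∀ {E F} → E ≈D F → I E → I F) →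
  (∀ {E F} → Step E F → I E → I F) → ∀ {X Y} → Reach X Y → I X → I Y
Reach-preserves I resp pres (done X≈Y)   = resp X≈Y
Reach-preserves I resp pres (step X↝ s) = pres s ∘ Reach-preserves I resp pres X↝

ghost-persists : ∀ {X Y i j} → Reach X Y → X i j ≡ ghost → Y i j ≡ ghost
ghost-persists {i = i} {j} =
  Reach-preserves (λ Z → Z i j ≡ ghost) (λ eq → trans (sym (eq i j))) ghost-preserved

Reach-box : ∀ {N X Y} → Reach X Y → Box N X → Box N Y
Reach-box {N} = Reach-preserves (Box N) (λ eq box i j out → trans (sym (eq i j)) (box i j out))
  box-preserved

Terminal : Grid → Set
Terminal m = ∀ F → ¬ Step m F

Terminal-Reach⇒≈ : ∀ {m X} → Terminal m → Reach m X → X ≈D m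
Terminal-Reach⇒≈ m-terminal (done m≈X)   i j = sym (m≈X i j)
Terminal-Reach⇒≈ m-terminal (step m↝ s) =
  ⊥-elim (m-terminal _ (Step-respˡ (Terminal-Reach⇒≈ m-terminal m↝) s))

Terminal⇒IsMinimal : ∀ {D m} → Reach D m → Terminal m → IsMinimal D m
Terminal⇒IsMinimal D↝m m-terminal = D↝m , λ X _ m↝X → Terminal-Reach⇒≈ m-terminal m↝X

terminal-reachable : ∀ {N X} → Box N X → ¬ ¬ (∃ λ m → Terminal m × Reach X m)
terminal-reachable {N} box = go box (<-wellFounded _)
  where
  go : ∀ {X} → Box N X → Acc _<_ (potential N X) → ¬ ¬ (∃ λ m → Terminal m × Reach X m)
  go {X} box (acc smaller) k = ¬¬-excluded-middle {A = ∃ (Step X)} λ where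
    (yes (F , s)) → go (box-preserved s box) (smaller (potential-decreasing box s))
      λ (m , m-terminal , F↝m) → k (m , m-terminal , Reach-trans (step (done ≈D-refl) s) F↝m)
    (no ¬step) → k (X , (λ F s → ¬step (F , s)) , done ≈D-refl)

-- Opaque, so that the implicit arguments of the lemmas about move Z t c e can be inferred.
opaque
  move : Grid → ℕ → ℕ → ℕ → Grid
  move Z t c e i j with j ≟ c | i ≟ t | i ≟ e
  ... | yes _ | yes _ | _     = ghost
  ... | yes _ | no _  | yes _ = ordinary
  ... | _     | _     | _     = Z i j

module _ {Z : Grid} {t c e : ℕ} where

  opaque
    unfolding move

    move-vacated : move Z t c e t c ≡ ghost
    move-vacated rewrite ≟-diag (refl {x = c}) | ≟-diag (refl {x = t}) = refl

    move-landing : e ≢ t → move Z t c e e c ≡ ordinary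
    move-landing e≢t rewrite ≟-diag (refl {x = c}) | ≟-diag (refl {x = e}) with e ≟ t
    ... | yes e≡t = ⊥-elim (e≢t e≡t)
    ... | no _    = refl

    move-frame : ∀ {i j} → ¬ (i ≡ t × j ≡ c) → ¬ (i ≡ e × j ≡ c) → move Z t c e i j ≡ Z i j
    move-frame {i} {j} ¬top ¬landing with j ≟ c | i ≟ t | i ≟ e
    ... | yes j≡c | yes i≡t | _       = ⊥-elim (¬top (i≡t , j≡c))
    ... | yes j≡c | no _    | yes i≡e = ⊥-elim (¬landing (i≡e , j≡c))
    ... | yes _   | no _    | no _    = refl
    ... | no _    | _       | _       = refl

  move-col : ∀ {i j} → j ≢ c → move Z t c e i j ≡ Z i j
  move-col j≢c = move-frame (j≢c ∘ proj₂) (j≢c ∘ proj₂)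

  move-below : ∀ {i j} → i < e → e < t → move Z t c e i j ≡ Z i j
  move-below i<e e<t = move-frame (<⇒≢ (<-trans i<e e<t) ∘ proj₁) (<⇒≢ i<e ∘ proj₁)

  move-above : ∀ {i j} → e < t → t < i → move Z t c e i j ≡ Z i j
  move-above e<t t<i = move-frame (>⇒≢ t<i ∘ proj₁) (>⇒≢ (<-trans e<t t<i) ∘ proj₁)

  fall-step : RightmostOrdinary Z t c → Landing Z t c e → Step Z (move Z t c e)
  fall-step (rightmost o rm) (landing e<t em bne bng) =
    t , c , e , o , rm , e<t , em , bne , bng , move-vacated , move-landing (<⇒≢ e<t) ,
    λ i j → move-frame

landing-exists : ∀ {Z t c f} → (∀ k → k < t → Z k c ≢ ghost) → Z f c ≡ empty → f < t →
  ∃ λ e → f ≤ e × Landing Z t c e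
landing-exists {Z} {c = c} ghost-free f-empty f<t
  with greatest-below (λ k → empty? (Z k c)) f-empty f<t
... | e , f≤e , e<t , e-empty , occupied =
  e , f≤e , landing e<t e-empty occupied λ k _ k<t → ghost-free k k<t

ghost-free-left-of-cell : ∀ {Y r c c'} → c' < c → Y r c ≢ empty → Y r c' ≢ ghost →
  ∀ {W} → Reach Y W → W r c' ≢ ghost
ghost-free-left-of-cell {r = r} {c} {c'} c'<c occupied not-ghost Y↝W =
  proj₂ (Reach-preserves I resp pres Y↝W (occupied , not-ghost))
  where
  I : Grid → Set
  I Z = Z r c ≢ empty × Z r c' ≢ ghost
  resp : ∀ {E F} → E ≈D F → I E → I F
  resp eq (occupied , not-ghost) = occupied ∘ trans (eq r c) , not-ghost ∘ trans (eq r c')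
  pres : ∀ {E F} → Step E F → I E → I F
  pres s (occupied , not-ghost) =
    nonempty-preserved s occupied ,
    λ ghost-at → occupied (empty-beyond (proj₁ (new-ghost s not-ghost ghost-at)) c c'<c)

ghost-free-above-ghost : ∀ {Y k t c} → k < t → Y k c ≡ ghost →
  (∀ j → k < j → j < t → Y j c ≢ empty) → Y t c ≢ ghost →
  ∀ {W} → Reach Y W → W t c ≢ ghost
ghost-free-above-ghost {k = k} {t} {c} k<t ghost-at occupied not-ghost Y↝W =
  proj₂ (proj₂ (Reach-preserves I resp pres Y↝W (ghost-at , occupied , not-ghost)))
  where
  I : Grid → Set
  I Z = Z k c ≡ ghost × (∀ j → k < j → j < t → Z j c ≢ empty) × Z t c ≢ ghost
  resp : ∀ {E F} → E ≈D F → I E → I F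
  resp eq (ghost-at , occupied , not-ghost) =
    trans (sym (eq k c)) ghost-at , (λ j k<j j<t → occupied j k<j j<t ∘ trans (eq j c)) ,
    not-ghost ∘ trans (eq t c)
  blocked : ∀ {E e} → E k c ≡ ghost → (∀ j → k < j → j < t → E j c ≢ empty) →
    ¬ Landing E t c e
  blocked {e = e} ghost-at occupied l with <-cmp e k
  ... | tri< e<k _ _ = ghost-free-above-landing l k e<k k<t ghost-at
  ... | tri≈ _ refl _ = ≡empty⇒≢ghost (empty-landing l) ghost-at
  ... | tri> _ _ k<e = occupied e k<e (landing<top l) (empty-landing l)
  pres : ∀ {E F} → Step E F → I E → I F
  pres s (ghost-at , occupied , not-ghost) =
    ghost-preserved s ghost-at ,
    (λ j k<j j<t → nonempty-preserved s (occupied j k<j j<t)) ,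
    λ ghost-now → blocked ghost-at occupied (proj₂ (proj₂ (new-ghost s not-ghost ghost-now)))

rightmost-unique : ∀ {Z r c d} → RightmostCol Z r c → RightmostCol Z r d → c ≡ d
rightmost-unique {c = c} {d} (c-occupied , beyond-c) (d-occupied , beyond-d) with <-cmp c d
... | tri< c<d _ _ = ⊥-elim (d-occupied (beyond-c d c<d))
... | tri≈ _ c≡d _ = c≡d
... | tri> _ _ d<c = ⊥-elim (c-occupied (beyond-d c d<c))

rightmost-exists : ∀ {N Z r c} → Box N Z → Z r c ≢ empty → ∃ λ c* → c ≤ c* × RightmostCol Z r c*
rightmost-exists {N} {Z} {r} box occupied
  with greatest-below (λ d → ¬? (empty? (Z r d))) occupied (proj₂ (inside-box box occupied))
... | c* , c≤c* , _ , c*-occupied , none-below-N = c* , c≤c* , c*-occupied , empty-beyond-c*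
  where
  empty-beyond-c* : ∀ d → c* < d → Z r d ≡ empty
  empty-beyond-c* d c*<d with d <? N
  ... | yes d<N = decidable-stable (empty? (Z r d)) (none-below-N d c*<d d<N)
  ... | no d≮N  = box r d (inj₂ (≮⇒≥ d≮N))

RightmostCol⇒RightmostOrdinary : ∀ {Z r c} → NoGhosts Z → RightmostCol Z r c →
  RightmostOrdinary Z r c
RightmostCol⇒RightmostOrdinary no-ghosts (occupied , beyond) =
  rightmost (≢empty∧≢ghost⇒≡ordinary occupied (no-ghosts _ _)) beyond

UniqueMinimal : Grid → Set
UniqueMinimal D = ∃ λ m → IsMinimal D m × (∀ m' → IsMinimal D m' → m' ≈D m)

ghost-forced : ∀ {N D X Y} i j → Box N D → UniqueMinimal D → Reach D X → X i j ≡ ghost →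
  Reach D Y → ¬ (∀ {W} → Reach Y W → W i j ≢ ghost)
ghost-forced i j D-box (m , _ , unique) D↝X ghost-at D↝Y never-ghost =
  terminal-reachable (Reach-box D↝X D-box) λ (m₁ , m₁-terminal , X↝m₁) →
  terminal-reachable (Reach-box D↝Y D-box) λ (m₂ , m₂-terminal , Y↝m₂) →
  never-ghost Y↝m₂ (begin
    m₂ i j ≡⟨ unique m₂ (Terminal⇒IsMinimal (Reach-trans D↝Y Y↝m₂) m₂-terminal) i j ⟩
    m i j  ≡⟨ sym (unique m₁ (Terminal⇒IsMinimal (Reach-trans D↝X X↝m₁) m₁-terminal) i j) ⟩
    m₁ i j ≡⟨ ghost-persists X↝m₁ ghost-at ⟩
    ghost  ∎)
  where open ≡-Reasoning

-- A descent c ≥ c' between rows r > r' of the free cell sequence, in a form that survives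
-- letting the cell (r, c) fall: only the lower row needs a hole below its rightmost cell.
record Descent (Z : Grid) : Set where
  field
    upper lower upper-col lower-col hole : ℕ
    lower<upper         : lower < upper
    lower-col≤upper-col : lower-col ≤ upper-col
    upper-top           : RightmostOrdinary Z upper upper-col
    lower-top           : RightmostOrdinary Z lower lower-col
    hole<lower          : hole < lower
    hole-empty          : Z hole lower-col ≡ empty
    ghost-free-below    : ∀ k j → k < upper → Z k j ≢ ghost
    clear-between       : ∀ k j → lower < k → k < upper → upper-col < j → Z k j ≡ empty

fall-descent : ∀ {Z e} (δ : Descent Z) → let open Descent δ in
  Landing Z upper upper-col e → lower < e → Descent (move Z upper upper-col e)
fall-descent {Z} {e} δ l lower<e = record
  { upper = e ; lower = lower ; upper-col = upper-col ; lower-col = lower-col ; hole = hole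
  ; lower<upper = lower<e
  ; lower-col≤upper-col = lower-col≤upper-col
  ; upper-top = rightmost (move-landing (<⇒≢ e<t)) λ j c<j →
      trans (move-col (>⇒≢ c<j)) (clear-between e j lower<e e<t c<j)
  ; lower-top = rightmost (trans (move-below lower<e e<t) (ordinary-at lower-top)) λ j c'<j →
      trans (move-below lower<e e<t) (empty-beyond lower-top j c'<j)
  ; hole<lower = hole<lower
  ; hole-empty = trans (move-below (<-trans hole<lower lower<e) e<t) hole-empty
  ; ghost-free-below = λ k j k<e →
      ghost-free-below k j (<-trans k<e e<t) ∘ trans (sym (move-below k<e e<t))
  ; clear-between = λ k j lower<k k<e c<j →
      trans (move-col (>⇒≢ c<j)) (clear-between k j lower<k (<-trans k<e e<t) c<j)
  }
  where
  open Descent δ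
  e<t : e < upper
  e<t = landing<top l

module _ {N : ℕ} {D : Grid} (D-box : Box N D) (D-min : UniqueMinimal D) where

  no-landing-beside-falling-cell : ∀ {Z t c r c' e} → Reach D Z →
    RightmostOrdinary Z t c → Landing Z t c r →
    RightmostOrdinary Z r c' → c' < c → Landing Z r c' e → ⊥
  no-landing-beside-falling-cell {r = r} {c' = c'} D↝Z t-top t-lands r-top c'<c r-lands =
    ghost-forced r c' D-box D-min (step D↝Z (fall-step r-top r-lands)) move-vacated
      (step D↝Z (fall-step t-top t-lands))
      (ghost-free-left-of-cell c'<c
        (≡ordinary⇒≢empty (move-landing (<⇒≢ (landing<top t-lands))))
        (≡ordinary⇒≢ghost (trans (move-col (<⇒≢ c'<c)) (ordinary-at r-top))))

  no-landing-under-falling-cell : ∀ {Z t c e r e'} → Reach D Z →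
    RightmostOrdinary Z t c → Landing Z t c e → e < r → r < t →
    RightmostOrdinary Z r c → Landing Z r c e' → ⊥
  no-landing-under-falling-cell {Z} {t} {c} {e} {r} {e'} D↝Z t-top t-lands e<r r<t r-top r-lands =
    ghost-forced t c D-box D-min (step D↝Z (fall-step t-top t-lands)) move-vacated
      (step D↝Z (fall-step r-top r-lands))
      (ghost-free-above-ghost r<t move-vacated occupied
        (≡ordinary⇒≢ghost (trans (move-above (landing<top r-lands) r<t) (ordinary-at t-top))))
    where
    occupied : ∀ k → r < k → k < t → move Z r c e' k c ≢ empty
    occupied k r<k k<t = occupied-above-landing t-lands k (<-trans e<r r<k) k<t
                       ∘ trans (sym (move-above (landing<top r-lands) r<k))

  no-descent : ∀ {Z} → Reach D Z → (δ : Descent Z) → Acc _<_ (Descent.upper δ) → ⊥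
  no-descent {Z} D↝Z δ (acc smaller) = by-columns (m≤n⇒m<n∨m≡n lower-col≤upper-col)
    where
    open Descent δ

    ghost-free-under-upper : ∀ k → k < upper → Z k upper-col ≢ ghost
    ghost-free-under-upper k = ghost-free-below k upper-col

    lower-landing : ∃ λ e → hole ≤ e × Landing Z lower lower-col e
    lower-landing = landing-exists
      (λ k k<lower → ghost-free-below k lower-col (<-trans k<lower lower<upper))
      hole-empty hole<lower

    lower-lands : Landing Z lower lower-col (proj₁ lower-landing)
    lower-lands = proj₂ (proj₂ lower-landing)

    upper-lands-above-lower : ∀ {e} → Landing Z upper upper-col e → lower < e → ⊥
    upper-lands-above-lower l lower<e =
      no-descent (step D↝Z (fall-step upper-top l)) (fall-descent δ l lower<e)
        (smaller (landing<top l))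

    by-columns : lower-col < upper-col ⊎ lower-col ≡ upper-col → ⊥
    by-columns (inj₁ lower-col<upper-col)
      with landing-exists ghost-free-under-upper
             (empty-beyond lower-top upper-col lower-col<upper-col) lower<upper
    ... | e , lower≤e , l with m≤n⇒m<n∨m≡n lower≤e
    ...   | inj₁ lower<e = upper-lands-above-lower l lower<e
    ...   | inj₂ refl    =
      no-landing-beside-falling-cell D↝Z upper-top l lower-top lower-col<upper-col lower-lands
    by-columns (inj₂ same-col)
      with landing-exists ghost-free-under-upper
             (subst (λ c → Z hole c ≡ empty) same-col hole-empty) (<-trans hole<lower lower<upper)
    ... | e , _ , l with <-cmp e lower
    ...   | tri< e<lower _ _ =
      no-landing-under-falling-cell D↝Z upper-top l e<lower lower<upper
        (subst (RightmostOrdinary Z lower) same-col lower-top)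
        (subst (λ c → Landing Z lower c (proj₁ lower-landing)) same-col lower-lands)
    ...   | tri≈ _ refl _ =
      ≡ordinary⇒≢empty (ordinary-at lower-top)
        (subst (λ c → Z e c ≡ empty) (sym same-col) (empty-landing l))
    ...   | tri> _ _ lower<e = upper-lands-above-lower l lower<e

  -- A row between r' and r reaching right of column c would form a lower such pair with r'.
  no-free-row-descent : NoGhosts D → ∀ {r r' c c' f'} → Acc _<_ r →
    RightmostOrdinary D r c → RightmostOrdinary D r' c' → f' < r' → D f' c' ≡ empty →
    r' < r → c' ≤ c → ⊥
  no-free-row-descent no-ghosts {r} {r'} {c} {c'} {f'} (acc smaller)
    r-top r'-top f'<r' hole-empty r'<r c'≤c =
    no-descent (done ≈D-refl) descent (<-wellFounded r)
    where
    clear-between : ∀ k j → r' < k → k < r → c < j → D k j ≡ empty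
    clear-between k j r'<k k<r c<j with empty? (D k j)
    ... | yes k-empty = k-empty
    ... | no k-occupied with rightmost-exists D-box k-occupied
    ...   | c* , j≤c* , k-rightmost =
      ⊥-elim (no-free-row-descent no-ghosts (smaller k<r)
        (RightmostCol⇒RightmostOrdinary no-ghosts k-rightmost) r'-top f'<r' hole-empty r'<k
        (≤-trans c'≤c (<⇒≤ (<-≤-trans c<j j≤c*))))

    descent : Descent D
    descent = record
      { upper = r ; lower = r' ; upper-col = c ; lower-col = c' ; hole = f'
      ; lower<upper = r'<r
      ; lower-col≤upper-col = c'≤c
      ; upper-top = r-top
      ; lower-top = r'-top
      ; hole<lower = f'<r'
      ; hole-empty = hole-empty
      ; ghost-free-below = λ k j _ → no-ghosts k j
      ; clear-between = clear-between
      }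

theorem3p13 : (D : Grid) → Finite D → NoGhosts D → Bounded D →
    FreeCellSeqStrictlyIncreasing D
theorem3p13 D (N , D-box) no-ghosts (D-min , _) r r' c c' _
  (c₀ , f' , f'<r' , r'-ordinary , f'-empty , beyond-c₀) r'<r r-rightmost r'-rightmost =
  ≰⇒> λ c'≤c → no-free-row-descent D-box D-min no-ghosts (<-wellFounded r)
    (RightmostCol⇒RightmostOrdinary no-ghosts r-rightmost)
    (RightmostCol⇒RightmostOrdinary no-ghosts r'-rightmost)
    f'<r' (subst (λ x → D f' x ≡ empty) c₀≡c' f'-empty) r'<r c'≤c
  where
  c₀≡c' : c₀ ≡ c'
  c₀≡c' = rightmost-unique {D} {r'} (≡ordinary⇒≢empty r'-ordinary , beyond-c₀) r'-rightmost
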